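{- Let $q\equiv 1\pmod 4$ be a prime power, let $(a,b)\in V(\mathbb{F}_q)$, and let $(c,d)\in V(\mathbb{F}_q)$ satisfy $\lambda(c,d)=1-\lambda(a,b)$. Then $(a,b)$ has a grandparent in $A(\mathbb{F}_q)$ if and only if $(c,d)$ has a child in $A(\mathbb{F}_q)$.
   Context: $V(\mathbb{F}_q)=\{(a,b)\in\mathbb{F}_q^2: a\neq 0,\ b\neq 0,\ a\neq \pm b\}$. For $(a,b)\in V(\mathbb{F}_q)$: if $ab$ is a square in $\mathbb{F}_q^\times$, $\mathrm{AGM}(a,b)=\{(\tfrac{a+b}{2},s),(\tfrac{a+b}{2},-s)\}$ with $s^2=ab$; otherwise $\mathrm{AGM}(a,b)=\varnothing$. The aquarium $A(\mathbb{F}_q)$ is the directed graph on $V(\mathbb{F}_q)$ with an edge $(a,b)\to(a',b')$ iff $(a',b')\in\mathrm{AGM}(a,b)$; then $(a',b')$ is a child of $(a,b)$ and $(a,b)$ a parent of $(a',b')$. A grandparent of $P$ is a parent of a parent of $P$. $\lambda(a,b)=b^2/a^2$. -}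

module Defs where

open import Level using (0ℓ)
open import Data.Nat as ℕ using (ℕ; suc)
open import Data.Nat.Primality using (Prime)
open import Data.Fin using (Fin)
open import Data.Product using (Σ; ∃; _×_; _,_)
open import Relation.Nullary using (¬_)
open import Relation.Binary.PropositionalEquality using (_≡_)
open import Algebra.Bundles using (CommutativeRing)

IsPrimePower : ℕ → Set
IsPrimePower q = Σ ℕ λ p → Σ ℕ λ k → Prime p × q ≡ p ℕ.^ suc k

-- A field: a nontrivial commutative ring (setoid equality _≈_) with an
-- inverse operation that inverts every nonzero element (value at 0 irrelevant).
record Field : Set₁ where
  field
    commRing : CommutativeRing 0ℓ 0ℓ
  open CommutativeRing commRing public
  field
    _⁻¹      : Carrier → Carrier
    1≉0      : ¬ (1# ≈ 0#)
    inverseʳ : ∀ x → ¬ (x ≈ 0#) → x * (x ⁻¹) ≈ 1#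

record HasCard (F : Field) (q : ℕ) : Set where
  open Field F
  field
    enum       : Fin q → Carrier
    enum-surj  : ∀ x → ∃ λ i → enum i ≈ x
    enum-inj   : ∀ i j → enum i ≈ enum j → i ≡ j

module Aquarium (F : Field) where
  open Field F

  two : Carrier
  two = 1# + 1#

  InV : Carrier → Carrier → Set
  InV a b = ¬ (a ≈ 0#) × ¬ (b ≈ 0#) × ¬ (a ≈ b) × ¬ (a ≈ - b)

  IsSquare : Carrier → Set
  IsSquare x = ∃ λ s → s * s ≈ x

  -- (a',b') ∈ AGM(a,b): ab is a square, a' = (a+b)/2, b' = ±s with s² = ab
  -- (equivalently b'² = ab, since the two square roots of ab are ±s).
  InAGM : Carrier → Carrier → Carrier → Carrier → Set
  InAGM a b a' b' =
    IsSquare (a * b) × a' ≈ (a + b) * (two ⁻¹) × b' * b' ≈ a * b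

  Edge : Carrier → Carrier → Carrier → Carrier → Set
  Edge a b a' b' = InV a b × InV a' b' × InAGM a b a' b'

  HasChild : Carrier → Carrier → Set
  HasChild a b = ∃ λ a' → ∃ λ b' → Edge a b a' b'

  HasParent : Carrier → Carrier → Set
  HasParent a b = ∃ λ a' → ∃ λ b' → Edge a' b' a b

  HasGrandparent : Carrier → Carrier → Set
  HasGrandparent a b =
    ∃ λ a₁ → ∃ λ b₁ → ∃ λ a₂ → ∃ λ b₂ → Edge a₂ b₂ a₁ b₁ × Edge a₁ b₁ a b

  lam : Carrier → Carrier → Carrier
  lam a b = (b * b) * ((a * a) ⁻¹)

-- A parent of (a, b) has the form (a + t, a - t) with t² = a² - b², and such a parent
-- has a parent of its own iff (a + t)² - (a - t)² = 4at is a square.  So (a, b) has a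
-- grandparent iff at is a square for one of the two roots t of a² - b².  The hypothesis
-- on λ says that r = ad/c is such a root, and ar = (a/c)² cd.  As q is odd, 2 ≠ 0 in F
-- (else x ↦ x + 1 would pair off the elements of F), and as q ≡ 1 (mod 4), -1 is a square
-- (else the Klein four-group generated by x ↦ -x and x ↦ 1/x would act freely on
-- F ∖ {0, 1, -1}, forcing 4 ∣ q - 3).  Hence the sign of t is irrelevant, and (a, b) has
-- a grandparent iff cd is a square, i.e. iff (c, d) has a child.
module Submission where

open import Defs
open import Algebra.Bundles using (CommutativeRing)
import Data.Fin as Fin
open import Data.Integer as ℤ using (ℤ; +_; -[1+_]; _⊖_; _◃_; sign; ∣_∣)
import Data.Integer.Properties as ℤ
open import Data.List using (List; []; _∷_; length; filter; tabulate)
open import Data.List.Properties using (filter-all; length-tabulate)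
open import Data.List.Relation.Unary.All as All using (All; []; _∷_)
open import Data.List.Relation.Unary.AllPairs using ([]; _∷_)
open import Data.List.Relation.Unary.Any as Any using (here; there; any?)
open import Data.Maybe using (Maybe; just; nothing)
open import Data.Nat as ℕ using (ℕ; zero; suc; _%_; _<_; z<s)
import Data.Nat.Properties as ℕ
open import Data.Nat.DivMod using ([m+kn]%n≡m%n)
open import Data.Nat.Divisibility using (_∣_; divides; _∣0; ∣-refl; ∣m∣n⇒∣m+n; ∣1⇒≡1; %-presˡ-∣)
open import Data.Nat.Induction using (<-wellFounded)
open import Data.Product using (∃; _×_; _,_; proj₁; proj₂)
open import Data.Sign as Sign using (Sign)
open import Data.Sum using (_⊎_; inj₁; inj₂)
open import Function.Base using (_∘_)
open import Function.Bundles using (_⇔_; mk⇔; Equivalence)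
open import Function.Construct.Symmetry using (⇔-sym)
open import Function.Related.Propositional using (module EquationalReasoning; equivalence)
open import Induction.WellFounded using (Acc; acc)
open import Level using (0ℓ)
open import Relation.Binary.Bundles using (DecSetoid)
open import Relation.Binary.Definitions using (Decidable)
open import Relation.Binary.PropositionalEquality as ≡ using (_≡_; _≢_)
open import Relation.Nullary using (¬_; yes; no; contradiction)
open import Relation.Nullary.Decidable using (¬?; map′)

-- The map
-- uses the tail-call-optimised multiple, for which 1 · 1# is 1# definitionally, so that
-- the solver's constants match the literals occurring in goals.
module IntegerCoefficientSolver {c ℓ} (R : CommutativeRing c ℓ) where
  open CommutativeRing R
  open import Algebra.Properties.Ring ring using (-0#≈0#; -‿involutive; -‿distribˡ-*; -‿distribʳ-*; -‿+-comm)
  open import Algebra.Properties.CommutativeSemigroup +-commutativeSemigroup using (interchange)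
  open import Algebra.Properties.Semiring.Mult.TCOptimised semiring using (1+×; ×-homo-+; ×1-homo-*)
    renaming (_×_ to _·_)
  open import Algebra.Solver.Ring.AlmostCommutativeRing using (fromCommutativeRing; _-Raw-AlmostCommutative⟶_)
  open import Relation.Binary.Reasoning.Setoid setoid

  private
    signed : Sign → Carrier → Carrier
    signed Sign.+ x = x
    signed Sign.- x = - x

    fromℤ : ℤ → Carrier
    fromℤ i = signed (sign i) (∣ i ∣ · 1#)

    x-0≈x : ∀ x → x - 0# ≈ x
    x-0≈x x = trans (+-congˡ -0#≈0#) (+-identityʳ x)

    [a+x]-[a+y]≈x-y : ∀ a x y → (a + x) - (a + y) ≈ x - y
    [a+x]-[a+y]≈x-y a x y = begin
      (a + x) - (a + y)       ≈⟨ +-congˡ (-‿+-comm a y) ⟨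
      (a + x) + (- a + - y)   ≈⟨ interchange a x (- a) (- y) ⟩
      (a - a) + (x - y)       ≈⟨ +-congʳ (-‿inverseʳ a) ⟩
      0# + (x - y)            ≈⟨ +-identityˡ _ ⟩
      x - y                   ∎

    ⊖-homo : ∀ m n → fromℤ (m ⊖ n) ≈ m · 1# - n · 1#
    ⊖-homo zero    zero    = sym (x-0≈x 0#)
    ⊖-homo zero    (suc n) = sym (+-identityˡ _)
    ⊖-homo (suc m) zero    = sym (x-0≈x _)
    ⊖-homo (suc m) (suc n) rewrite ℤ.[1+m]⊖[1+n]≡m⊖n m n = begin
      fromℤ (m ⊖ n)                    ≈⟨ ⊖-homo m n ⟩
      m · 1# - n · 1#                  ≈⟨ [a+x]-[a+y]≈x-y 1# _ _ ⟨
      (1# + m · 1#) - (1# + n · 1#)    ≈⟨ +-cong (1+× m 1#) (-‿cong (1+× n 1#)) ⟨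
      suc m · 1# - suc n · 1#          ∎

    +-homo : ∀ i j → fromℤ (i ℤ.+ j) ≈ fromℤ i + fromℤ j
    +-homo (+ m)    (+ n)    = ×-homo-+ 1# m n
    +-homo (+ m)    -[1+ n ] = ⊖-homo m (suc n)
    +-homo -[1+ m ] (+ n)    = trans (⊖-homo n (suc m)) (+-comm _ _)
    +-homo -[1+ m ] -[1+ n ] = begin
      - (suc (suc (m ℕ.+ n)) · 1#)       ≡⟨ ≡.cong (λ k → - (suc k · 1#)) (ℕ.+-suc m n) ⟨
      - ((suc m ℕ.+ suc n) · 1#)         ≈⟨ -‿cong (×-homo-+ 1# (suc m) (suc n)) ⟩
      - (suc m · 1# + suc n · 1#)        ≈⟨ -‿+-comm _ _ ⟨
      - (suc m · 1#) + - (suc n · 1#)    ∎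

    signed-cong : ∀ s {x y} → x ≈ y → signed s x ≈ signed s y
    signed-cong Sign.+ x≈y = x≈y
    signed-cong Sign.- x≈y = -‿cong x≈y

    signed-* : ∀ s t x y → signed (s Sign.* t) (x * y) ≈ signed s x * signed t y
    signed-* Sign.+ Sign.+ x y = refl
    signed-* Sign.+ Sign.- x y = -‿distribʳ-* x y
    signed-* Sign.- Sign.+ x y = -‿distribˡ-* x y
    signed-* Sign.- Sign.- x y = begin
      x * y          ≈⟨ -‿involutive _ ⟨
      - - (x * y)    ≈⟨ -‿cong (-‿distribˡ-* x y) ⟩
      - (- x * y)    ≈⟨ -‿distribʳ-* (- x) y ⟩
      - x * - y      ∎

    ◃-homo : ∀ s n → fromℤ (s ◃ n) ≈ signed s (n · 1#)
    ◃-homo Sign.+ zero    = refl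
    ◃-homo Sign.- zero    = sym -0#≈0#
    ◃-homo Sign.+ (suc n) = refl
    ◃-homo Sign.- (suc n) = refl

    *-homo : ∀ i j → fromℤ (i ℤ.* j) ≈ fromℤ i * fromℤ j
    *-homo i j = begin
      fromℤ (s ◃ ∣ i ∣ ℕ.* ∣ j ∣)           ≈⟨ ◃-homo s (∣ i ∣ ℕ.* ∣ j ∣) ⟩
      signed s ((∣ i ∣ ℕ.* ∣ j ∣) · 1#)     ≈⟨ signed-cong s (×1-homo-* ∣ i ∣ ∣ j ∣) ⟩
      signed s (∣ i ∣ · 1# * ∣ j ∣ · 1#)    ≈⟨ signed-* (sign i) (sign j) _ _ ⟩
      fromℤ i * fromℤ j                     ∎
      where s = sign i Sign.* sign j

    -‿homo : ∀ i → fromℤ (ℤ.- i) ≈ - fromℤ i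
    -‿homo (+ zero)  = sym -0#≈0#
    -‿homo (+ suc n) = refl
    -‿homo -[1+ n ]  = sym (-‿involutive _)

    homomorphism : ℤ.+-*-rawRing -Raw-AlmostCommutative⟶ fromCommutativeRing R
    homomorphism = record
      { ⟦_⟧ = fromℤ ; +-homo = +-homo ; *-homo = *-homo ; -‿homo = -‿homo ; 0-homo = refl ; 1-homo = refl }

    coefficients≟ : ∀ i j → Maybe (fromℤ i ≈ fromℤ j)
    coefficients≟ i j with i ℤ.≟ j
    ... | yes ≡.refl = just refl
    ... | no _       = nothing

  open import Algebra.Solver.Ring ℤ.+-*-rawRing (fromCommutativeRing R) homomorphism coefficients≟ public

module OrbitCounting {c ℓ} (S : DecSetoid c ℓ) where
  open DecSetoid S renaming (Carrier to A)
  open import Data.List.Membership.Setoid setoid using (_∈_; _∉_)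
  open import Data.List.Membership.Setoid.Properties using (∈-resp-≈; ∈-filter⁺; ∈-filter⁻; All[≉]⇒∉)
  open import Data.List.Relation.Unary.Unique.Setoid setoid using (Unique)
  open import Data.List.Relation.Unary.Unique.Setoid.Properties using (filter⁺)

  private
    ≉-respʳ : ∀ {x y z} → y ≈ z → ¬ x ≈ y → ¬ x ≈ z
    ≉-respʳ y≈z x≉y x≈z = x≉y (trans x≈z (sym y≈z))

    ≉-respˡ : ∀ {x y z} → x ≈ y → ¬ y ≈ z → ¬ x ≈ z
    ≉-respˡ x≈y y≉z x≈z = y≉z (trans (sym x≈y) x≈z)

  remove : A → List A → List A
  remove x = filter (λ y → ¬? (x ≟ y))

  ∈-remove⁺ : ∀ {x y L} → y ∈ L → ¬ x ≈ y → y ∈ remove x L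
  ∈-remove⁺ {x} = ∈-filter⁺ setoid (λ y → ¬? (x ≟ y)) ≉-respʳ

  ∈-remove⁻ : ∀ {x y L} → y ∈ remove x L → y ∈ L × ¬ x ≈ y
  ∈-remove⁻ {x} = ∈-filter⁻ setoid (λ y → ¬? (x ≟ y)) ≉-respʳ

  length-remove : ∀ {x L} → Unique L → x ∈ L → length L ≡ suc (length (remove x L))
  length-remove {x} {y ∷ L} (y≉L ∷ _) _ with x ≟ y
  ... | yes x≈y = ≡.cong suc (≡.sym (≡.cong length (filter-all (λ z → ¬? (x ≟ z)) (All.map (≉-respˡ x≈y) y≉L))))
  length-remove {x} {y ∷ L} _        (here x≈y)  | no x≉y = contradiction x≈y x≉y
  length-remove {x} {y ∷ L} (_ ∷ uL) (there x∈L) | no _   = ≡.cong suc (length-remove uL x∈L)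

  infixl 5 _∖_
  _∖_ : List A → List A → List A
  L ∖ []      = L
  L ∖ (b ∷ B) = remove b (L ∖ B)

  ∈-∖⁺ : ∀ {y L B} → y ∈ L → y ∉ B → y ∈ L ∖ B
  ∈-∖⁺ {B = []}    y∈L _   = y∈L
  ∈-∖⁺ {B = b ∷ B} y∈L y∉B = ∈-remove⁺ (∈-∖⁺ y∈L (y∉B ∘ there)) (λ b≈y → y∉B (here (sym b≈y)))

  ∈-∖⁻ : ∀ {y L B} → y ∈ L ∖ B → y ∈ L × y ∉ B
  ∈-∖⁻ {B = []}    y∈L = y∈L , λ ()
  ∈-∖⁻ {B = b ∷ B} y∈  with ∈-remove⁻ y∈
  ... | y∈L∖B , b≉y with ∈-∖⁻ y∈L∖B
  ... | y∈L , y∉B = y∈L , λ { (here y≈b) → b≉y (sym y≈b) ; (there y∈B) → y∉B y∈B }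

  ∖-unique : ∀ {L} B → Unique L → Unique (L ∖ B)
  ∖-unique []      uL = uL
  ∖-unique (b ∷ B) uL = filter⁺ setoid (λ y → ¬? (b ≟ y)) (∖-unique B uL)

  length-∖ : ∀ {L B} → Unique L → Unique B → All (_∈ L) B → length L ≡ length B ℕ.+ length (L ∖ B)
  length-∖ {B = []}    _  _          _           = ≡.refl
  length-∖ {L} {b ∷ B} uL (b≉B ∷ uB) (b∈L ∷ B⊆L) = begin
    length L                                 ≡⟨ length-∖ uL uB B⊆L ⟩
    length B ℕ.+ length (L ∖ B)              ≡⟨ ≡.cong (length B ℕ.+_) (length-remove (∖-unique B uL) b∈L∖B) ⟩
    length B ℕ.+ suc (length (L ∖ (b ∷ B)))  ≡⟨ ℕ.+-suc _ _ ⟩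
    suc (length B ℕ.+ length (L ∖ (b ∷ B)))  ∎
    where
    open ≡.≡-Reasoning
    b∈L∖B = ∈-∖⁺ b∈L (All[≉]⇒∉ setoid b≉B)

  ClosedUnder : (A → A) → List A → Set _
  ClosedUnder f L = ∀ {y} → y ∈ L → f y ∈ L

  ∖-closedUnder : ∀ {f L B} → (∀ y → f (f y) ≈ y) →
                  ClosedUnder f L → ClosedUnder f B → ClosedUnder f (L ∖ B)
  ∖-closedUnder f-involutive closedL closedB y∈ with ∈-∖⁻ y∈
  ... | y∈L , y∉B = ∈-∖⁺ (closedL y∈L) (λ fy∈B → y∉B (∈-resp-≈ setoid (f-involutive _) (closedB fy∈B)))

  closedUnder-fromAll : ∀ {f B} → (∀ {x y} → x ≈ y → f x ≈ f y) → All (λ b → f b ∈ B) B → ClosedUnder f B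
  closedUnder-fromAll {f} {B} f-cong = go
    where
    go : ∀ {C} → All (λ b → f b ∈ B) C → ∀ {y} → y ∈ C → f y ∈ B
    go (fb∈B ∷ _)  (here y≈b)  = ∈-resp-≈ setoid (f-cong (sym y≈b)) fb∈B
    go (_ ∷ fC∈B) (there y∈C) = go fC∈B y∈C

  module _ {p} (Closed : List A → Set p) (block : A → List A) (k : ℕ)
           (length-block : ∀ x → length (block x) ≡ suc k)
           (block-unique : ∀ {x L} → Closed L → x ∈ L → Unique (block x))
           (block-⊆ : ∀ {x L} → Closed L → x ∈ L → All (_∈ L) (block x))
           (∖-closed : ∀ {x L} → Closed L → Closed (L ∖ block x)) where

    blocks-∣-length : ∀ {L} → Unique L → Closed L → suc k ∣ length L
    blocks-∣-length {L} = go L (<-wellFounded (length L))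
      where
      go : ∀ L → Acc _<_ (length L) → Unique L → Closed L → suc k ∣ length L
      go []        _         _  _       = suc k ∣0
      go L@(x ∷ _) (acc rec) uL closedL =
        ≡.subst (suc k ∣_) (≡.sym length-L)
                (∣m∣n⇒∣m+n ∣-refl (go (L ∖ B) (rec shorter) (∖-unique B uL) (∖-closed closedL)))
        where
        x∈L = here refl
        B = block x
        length-L : length L ≡ suc k ℕ.+ length (L ∖ B)
        length-L = ≡.trans (length-∖ uL (block-unique closedL x∈L) (block-⊆ closedL x∈L))
                           (≡.cong (ℕ._+ length (L ∖ B)) (length-block x))
        shorter : length (L ∖ B) < length L
        shorter = ≡.subst (length (L ∖ B) <_) (≡.sym length-L) (ℕ.m<n+m _ z<s)

  module FreeInvolution {σ : A → A} (σ-cong : ∀ {x y} → x ≈ y → σ x ≈ σ y)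
                        (σ-involutive : ∀ x → σ (σ x) ≈ x) where

    pair : A → List A
    pair x = x ∷ σ x ∷ []

    Free : List A → Set _
    Free L = ClosedUnder σ L × (∀ {y} → y ∈ L → ¬ y ≈ σ y)

    pair-closed : ∀ x → ClosedUnder σ (pair x)
    pair-closed x = closedUnder-fromAll σ-cong (there (here refl) ∷ here (σ-involutive x) ∷ [])

    2∣length : ∀ {L} → Unique L → Free L → 2 ∣ length L
    2∣length = blocks-∣-length Free pair 1 (λ _ → ≡.refl)
      (λ (_ , free) x∈L → (free x∈L ∷ []) ∷ [] ∷ [])
      (λ (closed , _) x∈L → x∈L ∷ closed x∈L ∷ [])
      (λ {x} (closed , free) → ∖-closedUnder σ-involutive closed (pair-closed x) , free ∘ proj₁ ∘ ∈-∖⁻ {B = pair x})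

  module KleinFour {σ τ : A → A}
                   (σ-cong : ∀ {x y} → x ≈ y → σ x ≈ σ y) (τ-cong : ∀ {x y} → x ≈ y → τ x ≈ τ y)
                   (σ-involutive : ∀ x → σ (σ x) ≈ x) (τ-involutive : ∀ x → τ (τ x) ≈ x)
                   (στ≈τσ : ∀ x → σ (τ x) ≈ τ (σ x)) where

    orbit : A → List A
    orbit x = x ∷ σ x ∷ τ x ∷ σ (τ x) ∷ []

    Free : List A → Set _
    Free L = ClosedUnder σ L × ClosedUnder τ L × (∀ {y} → y ∈ L → Unique (orbit y))

    orbit-closedUnderσ : ∀ x → ClosedUnder σ (orbit x)
    orbit-closedUnderσ x = closedUnder-fromAll σ-cong
      (there (here refl) ∷ here (σ-involutive x) ∷ there (there (there (here refl))) ∷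
       there (there (here (σ-involutive (τ x)))) ∷ [])

    orbit-closedUnderτ : ∀ x → ClosedUnder τ (orbit x)
    orbit-closedUnderτ x = closedUnder-fromAll τ-cong
      (there (there (here refl)) ∷ there (there (there (here (sym (στ≈τσ x))))) ∷ here (τ-involutive x) ∷
       there (here (trans (τ-cong (στ≈τσ x)) (τ-involutive (σ x)))) ∷ [])

    4∣length : ∀ {L} → Unique L → Free L → 4 ∣ length L
    4∣length = blocks-∣-length Free orbit 3 (λ _ → ≡.refl)
      (λ (_ , _ , free) x∈L → free x∈L)
      (λ (closedσ , closedτ , _) x∈L → x∈L ∷ closedσ x∈L ∷ closedτ x∈L ∷ closedσ (closedτ x∈L) ∷ [])
      (λ {x} (closedσ , closedτ , free) →
        ∖-closedUnder σ-involutive closedσ (orbit-closedUnderσ x) ,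
        ∖-closedUnder τ-involutive closedτ (orbit-closedUnderτ x) ,
        free ∘ proj₁ ∘ ∈-∖⁻ {B = orbit x})

q%4≡1⇒2∤q : ∀ {q} → q % 4 ≡ 1 → ¬ 2 ∣ q
q%4≡1⇒2∤q q%4≡1 2∣q with ∣1⇒≡1 (≡.subst (2 ∣_) q%4≡1 (%-presˡ-∣ 2∣q (divides 2 ≡.refl)))
... | ()

q%4≡1⇒q≢3+4k : ∀ {q n} → q % 4 ≡ 1 → 4 ∣ n → q ≢ 3 ℕ.+ n
q%4≡1⇒q≢3+4k q%4≡1 (divides k ≡.refl) ≡.refl with ≡.trans (≡.sym q%4≡1) ([m+kn]%n≡m%n 3 k 4)
... | ()

module FieldProperties (F : Field) where
  open Field F
  open Aquarium F using (IsSquare; lam)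
  open IntegerCoefficientSolver commRing
  open import Algebra.Properties.Ring ring using (x∙y⁻¹≈ε⇒x≈y; +-inverseˡ-unique)
  open import Algebra.Properties.CommutativeSemigroup *-commutativeSemigroup using (interchange)
  open import Relation.Binary.Reasoning.Setoid setoid

  inverseˡ : ∀ x → ¬ x ≈ 0# → x ⁻¹ * x ≈ 1#
  inverseˡ x x≉0 = trans (*-comm _ _) (inverseʳ x x≉0)

  ⁻¹-cancelˡ : ∀ {x} y → ¬ x ≈ 0# → x ⁻¹ * (x * y) ≈ y
  ⁻¹-cancelˡ {x} y x≉0 = begin
    x ⁻¹ * (x * y)  ≈⟨ *-assoc _ _ _ ⟨
    x ⁻¹ * x * y    ≈⟨ *-congʳ (inverseˡ x x≉0) ⟩
    1# * y          ≈⟨ *-identityˡ y ⟩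
    y               ∎

  x*y≈0⇒y≈0 : ∀ {x y} → ¬ x ≈ 0# → x * y ≈ 0# → y ≈ 0#
  x*y≈0⇒y≈0 {x} {y} x≉0 xy≈0 = begin
    y               ≈⟨ ⁻¹-cancelˡ y x≉0 ⟨
    x ⁻¹ * (x * y)  ≈⟨ *-congˡ xy≈0 ⟩
    x ⁻¹ * 0#       ≈⟨ zeroʳ _ ⟩
    0#              ∎

  x≉0∧y≉0⇒x*y≉0 : ∀ {x y} → ¬ x ≈ 0# → ¬ y ≈ 0# → ¬ x * y ≈ 0#
  x≉0∧y≉0⇒x*y≉0 x≉0 y≉0 xy≈0 = y≉0 (x*y≈0⇒y≈0 x≉0 xy≈0)

  x*y≉0⇒x≉0 : ∀ {x y} → ¬ x * y ≈ 0# → ¬ x ≈ 0#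
  x*y≉0⇒x≉0 {x} {y} xy≉0 x≈0 = xy≉0 (trans (*-congʳ x≈0) (zeroˡ y))

  x*y≉0⇒y≉0 : ∀ {x y} → ¬ x * y ≈ 0# → ¬ y ≈ 0#
  x*y≉0⇒y≉0 {x} {y} xy≉0 y≈0 = xy≉0 (trans (*-congˡ y≈0) (zeroʳ x))

  x*x≈y∧y≉0⇒x≉0 : ∀ {x y} → x * x ≈ y → ¬ y ≈ 0# → ¬ x ≈ 0#
  x*x≈y∧y≉0⇒x≉0 x²≈y y≉0 = x*y≉0⇒x≉0 (y≉0 ∘ trans (sym x²≈y))

  x≉y⇒x-y≉0 : ∀ {x y} → ¬ x ≈ y → ¬ x - y ≈ 0#
  x≉y⇒x-y≉0 x≉y x-y≈0 = x≉y (x∙y⁻¹≈ε⇒x≈y _ _ x-y≈0)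

  x≉-y⇒x+y≉0 : ∀ {x y} → ¬ x ≈ - y → ¬ x + y ≈ 0#
  x≉-y⇒x+y≉0 x≉-y x+y≈0 = x≉-y (+-inverseˡ-unique _ _ x+y≈0)

  ⁻¹-unique : ∀ {x y} → x * y ≈ 1# → y ≈ x ⁻¹
  ⁻¹-unique {x} {y} xy≈1 = begin
    y               ≈⟨ ⁻¹-cancelˡ y x≉0 ⟨
    x ⁻¹ * (x * y)  ≈⟨ *-congˡ xy≈1 ⟩
    x ⁻¹ * 1#       ≈⟨ *-identityʳ _ ⟩
    x ⁻¹            ∎
    where
    x≉0 : ¬ x ≈ 0#
    x≉0 = x*y≉0⇒x≉0 (λ xy≈0 → 1≉0 (trans (sym xy≈1) xy≈0))

  ⁻¹-≉0 : ∀ {x} → ¬ x ≈ 0# → ¬ x ⁻¹ ≈ 0#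
  ⁻¹-≉0 {x} x≉0 = x*y≉0⇒y≉0 (λ xx⁻¹≈0 → 1≉0 (trans (sym (inverseʳ x x≉0)) xx⁻¹≈0))

  ⁻¹-distrib-* : ∀ {x y} → ¬ x ≈ 0# → ¬ y ≈ 0# → (x * y) ⁻¹ ≈ x ⁻¹ * y ⁻¹
  ⁻¹-distrib-* {x} {y} x≉0 y≉0 = sym (⁻¹-unique (begin
    x * y * (x ⁻¹ * y ⁻¹)    ≈⟨ interchange x y (x ⁻¹) (y ⁻¹) ⟩
    x * x ⁻¹ * (y * y ⁻¹)    ≈⟨ *-cong (inverseʳ x x≉0) (inverseʳ y y≉0) ⟩
    1# * 1#                  ≈⟨ *-identityˡ 1# ⟩
    1#                       ∎))

  IsSquare-cong : ∀ {x y} → x ≈ y → IsSquare x ⇔ IsSquare y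
  IsSquare-cong x≈y = mk⇔ (λ (s , s²≈x) → s , trans s²≈x x≈y) (λ (s , s²≈y) → s , trans s²≈y (sym x≈y))

  IsSquare-*-square⇔ : ∀ {u y} → ¬ u ≈ 0# → IsSquare (u * u * y) ⇔ IsSquare y
  IsSquare-*-square⇔ {u} {y} u≉0 = mk⇔
    (λ (s , s²≈u²y) → u ⁻¹ * s , (begin
      u ⁻¹ * s * (u ⁻¹ * s)        ≈⟨ solve 2 (λ v s → v :* s :* (v :* s) := v :* v :* (s :* s)) refl (u ⁻¹) s ⟩
      u ⁻¹ * u ⁻¹ * (s * s)        ≈⟨ *-congˡ s²≈u²y ⟩
      u ⁻¹ * u ⁻¹ * (u * u * y)    ≈⟨ solve 3 (λ v u y → v :* v :* (u :* u :* y) := v :* u :* (v :* u) :* y)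
                                              refl (u ⁻¹) u y ⟩
      u ⁻¹ * u * (u ⁻¹ * u) * y    ≈⟨ *-congʳ (*-cong (inverseˡ u u≉0) (inverseˡ u u≉0)) ⟩
      1# * 1# * y                  ≈⟨ solve 1 (λ y → con (+ 1) :* con (+ 1) :* y := y) refl y ⟩
      y                            ∎))
    (λ (s , s²≈y) → u * s , (begin
      u * s * (u * s)              ≈⟨ solve 2 (λ u s → u :* s :* (u :* s) := u :* u :* (s :* s)) refl u s ⟩
      u * u * (s * s)              ≈⟨ *-congˡ s²≈y ⟩
      u * u * y                    ∎))

  IsSquare-neg : ∀ {x} → IsSquare (- 1#) → IsSquare (- x) → IsSquare x
  IsSquare-neg {x} (i , i²≈-1) (s , s²≈-x) = i * s , (begin
    i * s * (i * s)    ≈⟨ solve 2 (λ i s → i :* s :* (i :* s) := i :* i :* (s :* s)) refl i s ⟩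
    i * i * (s * s)    ≈⟨ *-cong i²≈-1 s²≈-x ⟩
    - 1# * - x         ≈⟨ solve 1 (λ x → :- con (+ 1) :* :- x := x) refl x ⟩
    x                  ∎)

  lam-complement⇒root : ∀ {a b c d} → ¬ a ≈ 0# → ¬ c ≈ 0# → lam c d ≈ 1# - lam a b →
                        a * d * c ⁻¹ * (a * d * c ⁻¹) ≈ a * a - b * b
  lam-complement⇒root {a} {b} {c} {d} a≉0 c≉0 λcd≈1-λab = begin
    a * d * c ⁻¹ * (a * d * c ⁻¹)
      ≈⟨ solve 3 (λ a d e → a :* d :* e :* (a :* d :* e) := a :* a :* (d :* d :* (e :* e))) refl a d (c ⁻¹) ⟩
    a * a * (d * d * (c ⁻¹ * c ⁻¹))
      ≈⟨ *-congˡ (*-congˡ (⁻¹-distrib-* c≉0 c≉0)) ⟨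
    a * a * lam c d
      ≈⟨ *-congˡ λcd≈1-λab ⟩
    a * a * (1# - b * b * (a * a) ⁻¹)
      ≈⟨ solve 3 (λ a b e → a :* a :* (con (+ 1) :- b :* b :* e) := a :* a :- b :* b :* (a :* a :* e))
                 refl a b ((a * a) ⁻¹) ⟩
    a * a - b * b * (a * a * (a * a) ⁻¹)
      ≈⟨ +-congˡ (-‿cong (*-congˡ (inverseʳ (a * a) (x≉0∧y≉0⇒x*y≉0 a≉0 a≉0)))) ⟩
    a * a - b * b * 1#
      ≈⟨ +-congˡ (-‿cong (*-identityʳ _)) ⟩
    a * a - b * b
      ∎

  a*[a*d*c⁻¹]≈[a*c⁻¹]²*[c*d] : ∀ {a c} d → ¬ c ≈ 0# →
                               a * (a * d * c ⁻¹) ≈ a * c ⁻¹ * (a * c ⁻¹) * (c * d)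
  a*[a*d*c⁻¹]≈[a*c⁻¹]²*[c*d] {a} {c} d c≉0 = begin
    a * (a * d * c ⁻¹)                 ≈⟨ *-identityʳ _ ⟨
    a * (a * d * c ⁻¹) * 1#            ≈⟨ *-congˡ (inverseʳ c c≉0) ⟨
    a * (a * d * c ⁻¹) * (c * c ⁻¹)    ≈⟨ solve 4 (λ a c d e → a :* (a :* d :* e) :* (c :* e) := a :* e :* (a :* e) :* (c :* d))
                                                  refl a c d (c ⁻¹) ⟩
    a * c ⁻¹ * (a * c ⁻¹) * (c * d)    ∎

module DecidableFieldProperties (F : Field) (_≟_ : Decidable (Field._≈_ F)) where
  open Field F
  open Aquarium F using (IsSquare)
  open FieldProperties F
  open IntegerCoefficientSolver commRing
  open import Algebra.Properties.Ring ring using (-0#≈0#; -‿distribʳ-*; x∙y⁻¹≈ε⇒x≈y; +-inverseˡ-unique)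
  open import Relation.Binary.Reasoning.Setoid setoid

  x²≈y²⇒x≈±y : ∀ {x y} → x * x ≈ y * y → x ≈ y ⊎ x ≈ - y
  x²≈y²⇒x≈±y {x} {y} x²≈y² with (x - y) ≟ 0#
  ... | yes x-y≈0 = inj₁ (x∙y⁻¹≈ε⇒x≈y _ _ x-y≈0)
  ... | no  x-y≉0 = inj₂ (+-inverseˡ-unique _ _ (x*y≈0⇒y≈0 x-y≉0 (begin
    (x - y) * (x + y)    ≈⟨ solve 2 (λ x y → (x :- y) :* (x :+ y) := x :* x :- y :* y) refl x y ⟩
    x * x - y * y        ≈⟨ +-congʳ x²≈y² ⟩
    y * y - y * y        ≈⟨ -‿inverseʳ _ ⟩
    0#                   ∎)))

  IsSquare-at-root⇔ : ∀ {a r D} → IsSquare (- 1#) → r * r ≈ D →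
                      (∃ λ t → t * t ≈ D × IsSquare (a * t)) ⇔ IsSquare (a * r)
  IsSquare-at-root⇔ {a} {r} -1-square r²≈D =
    mk⇔ (λ (t , t²≈D , square) → to (x²≈y²⇒x≈±y (trans t²≈D (sym r²≈D))) square) (λ square → r , r²≈D , square)
    where
    to : ∀ {t} → t ≈ r ⊎ t ≈ - r → IsSquare (a * t) → IsSquare (a * r)
    to (inj₁ t≈r)  = Equivalence.to (IsSquare-cong (*-congˡ t≈r))
    to (inj₂ t≈-r) = IsSquare-neg -1-square ∘ Equivalence.to (IsSquare-cong (trans (*-congˡ t≈-r) (sym (-‿distribʳ-* a r))))

  -- The inverse, made total by sending 0 to 0 so that it is an involution of the whole field.
  recip : Carrier → Carrier
  recip x with x ≟ 0#
  ... | yes _ = 0#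
  ... | no  _ = x ⁻¹

  recip-≈0 : ∀ {x} → x ≈ 0# → recip x ≈ 0#
  recip-≈0 {x} x≈0 with x ≟ 0#
  ... | yes _   = refl
  ... | no  x≉0 = contradiction x≈0 x≉0

  recip-inverseʳ : ∀ {x} → ¬ x ≈ 0# → x * recip x ≈ 1#
  recip-inverseʳ {x} x≉0 with x ≟ 0#
  ... | yes x≈0 = contradiction x≈0 x≉0
  ... | no  _   = inverseʳ x x≉0

  recip-unique : ∀ {x y} → x * y ≈ 1# → recip x ≈ y
  recip-unique {x} {y} xy≈1 with x ≟ 0#
  ... | yes x≈0 = contradiction (trans (sym xy≈1) (trans (*-congʳ x≈0) (zeroˡ y))) 1≉0
  ... | no  _   = sym (⁻¹-unique xy≈1)

  recip-cong : ∀ {x y} → x ≈ y → recip x ≈ recip y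
  recip-cong {x} {y} x≈y with y ≟ 0#
  ... | yes y≈0 = recip-≈0 (trans x≈y y≈0)
  ... | no  y≉0 = recip-unique (trans (*-congʳ x≈y) (inverseʳ y y≉0))

  recip-involutive : ∀ x → recip (recip x) ≈ x
  recip-involutive x with x ≟ 0#
  ... | yes x≈0 = trans (recip-≈0 refl) (sym x≈0)
  ... | no  x≉0 = recip-unique (inverseˡ x x≉0)

  -‿recip : ∀ x → - recip x ≈ recip (- x)
  -‿recip x with x ≟ 0#
  ... | yes x≈0 = trans -0#≈0# (sym (recip-≈0 (trans (-‿cong x≈0) -0#≈0#)))
  ... | no  x≉0 = sym (recip-unique (begin
    - x * - x ⁻¹    ≈⟨ solve 2 (λ x y → :- x :* :- y := x :* y) refl x (x ⁻¹) ⟩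
    x * x ⁻¹        ≈⟨ inverseʳ x x≉0 ⟩
    1#              ∎))

module OddCharacteristic (F : Field) (two≉0 : ¬ Field._≈_ F (Aquarium.two F) (Field.0# F)) where
  open Field F
  open Aquarium F using (two)
  open FieldProperties F
  open IntegerCoefficientSolver commRing
  open import Algebra.Properties.CommutativeSemigroup *-commutativeSemigroup using (x∙yz≈y∙xz)
  open import Relation.Binary.Reasoning.Setoid setoid

  𝟚 : ∀ {n} → Polynomial n
  𝟚 = con (+ 2)

  half : Carrier
  half = two ⁻¹

  half≉0 : ¬ half ≈ 0#
  half≉0 = ⁻¹-≉0 two≉0

  two*[x*half]≈x : ∀ x → two * (x * half) ≈ x
  two*[x*half]≈x x = begin
    two * (x * half)    ≈⟨ x∙yz≈y∙xz two x half ⟩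
    x * (two * half)    ≈⟨ *-congˡ (inverseʳ two two≉0) ⟩
    x * 1#              ≈⟨ *-identityʳ x ⟩
    x                   ∎

  [two*x]*half≈x : ∀ x → two * x * half ≈ x
  [two*x]*half≈x x = trans (*-assoc two x half) (two*[x*half]≈x x)

  [two*half]²≈1 : two * half * (two * half) ≈ 1#
  [two*half]²≈1 = trans (*-cong (inverseʳ two two≉0) (inverseʳ two two≉0)) (*-identityˡ 1#)

  two*x≈0⇒x≈0 : ∀ {x} → two * x ≈ 0# → x ≈ 0#
  two*x≈0⇒x≈0 = x*y≈0⇒y≈0 two≉0

  x≈-x⇒x≈0 : ∀ {x} → x ≈ - x → x ≈ 0#
  x≈-x⇒x≈0 {x} x≈-x = two*x≈0⇒x≈0 (begin
    two * x    ≈⟨ solve 1 (λ x → 𝟚 :* x := x :+ x) refl x ⟩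
    x + x      ≈⟨ +-congʳ x≈-x ⟩
    - x + x    ≈⟨ -‿inverseˡ x ⟩
    0#         ∎)

  two*two*x≈v²⇒x≈[v*half]² : ∀ {x v} → two * two * x ≈ v * v → x ≈ v * half * (v * half)
  two*two*x≈v²⇒x≈[v*half]² {x} {v} 4x≈v² = begin
    x                                ≈⟨ *-identityˡ x ⟨
    1# * x                           ≈⟨ *-congʳ [two*half]²≈1 ⟨
    two * half * (two * half) * x    ≈⟨ solve 2 (λ x h → 𝟚 :* h :* (𝟚 :* h) :* x := h :* h :* (𝟚 :* 𝟚 :* x)) refl x half ⟩
    half * half * (two * two * x)    ≈⟨ *-congˡ 4x≈v² ⟩
    half * half * (v * v)            ≈⟨ solve 2 (λ h v → h :* h :* (v :* v) := v :* h :* (v :* h)) refl half v ⟩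
    v * half * (v * half)            ∎

module AquariumProperties (F : Field) (two≉0 : ¬ Field._≈_ F (Aquarium.two F) (Field.0# F)) where
  open Field F
  open Aquarium F
  open FieldProperties F
  open OddCharacteristic F two≉0
  open IntegerCoefficientSolver commRing
  open import Relation.Binary.Reasoning.Setoid setoid

  mean⇒partner : ∀ {a x y} → a ≈ (x + y) * half → y ≈ two * a - x
  mean⇒partner {a} {x} {y} a≈mean = begin
    y                             ≈⟨ solve 2 (λ x y → y := (x :+ y) :- x) refl x y ⟩
    (x + y) - x                   ≈⟨ +-congʳ (two*[x*half]≈x (x + y)) ⟨
    two * ((x + y) * half) - x    ≈⟨ +-congʳ (*-congˡ a≈mean) ⟨
    two * a - x                   ∎

  agm-gap : ∀ {x y x' y'} → x' ≈ (x + y) * half → y' * y' ≈ x * y →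
            x' * x' - y' * y' ≈ (x - y) * half * ((x - y) * half)
  agm-gap {x} {y} {x'} {y'} x'≈mean y'²≈xy = begin
    x' * x' - y' * y'
      ≈⟨ +-cong (*-cong x'≈mean x'≈mean) (-‿cong y'²≈xy) ⟩
    (x + y) * half * ((x + y) * half) - x * y
      ≈⟨ +-congˡ (-‿cong (trans (*-congˡ [two*half]²≈1) (*-identityʳ _))) ⟨
    (x + y) * half * ((x + y) * half) - x * y * (two * half * (two * half))
      ≈⟨ solve 3 (λ x y h → (x :+ y) :* h :* ((x :+ y) :* h) :- x :* y :* (𝟚 :* h :* (𝟚 :* h))
                         := (x :- y) :* h :* ((x :- y) :* h)) refl x y half ⟩
    (x - y) * half * ((x - y) * half)
      ∎

  InV⇒a²-b²≉0 : ∀ {a b} → InV a b → ¬ a * a - b * b ≈ 0#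
  InV⇒a²-b²≉0 {a} {b} (_ , _ , a≉b , a≉-b) a²-b²≈0 =
    x≉0∧y≉0⇒x*y≉0 (x≉y⇒x-y≉0 a≉b) (x≉-y⇒x+y≉0 a≉-b)
      (trans (solve 2 (λ a b → (a :- b) :* (a :+ b) := a :* a :- b :* b) refl a b) a²-b²≈0)

  InV-± : ∀ {x y} → ¬ x ≈ 0# → ¬ y ≈ 0# → ¬ (x + y) * (x - y) ≈ 0# → InV (x + y) (x - y)
  InV-± {x} {y} x≉0 y≉0 p≉0 = x*y≉0⇒x≉0 p≉0 , x*y≉0⇒y≉0 p≉0 ,
    (λ x+y≈x-y → y≉0 (two*x≈0⇒x≈0 (begin
      two * y                ≈⟨ solve 2 (λ x y → 𝟚 :* y := (x :+ y) :- (x :- y)) refl x y ⟩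
      (x + y) - (x - y)      ≈⟨ +-congʳ x+y≈x-y ⟩
      (x - y) - (x - y)      ≈⟨ -‿inverseʳ _ ⟩
      0#                     ∎))) ,
    (λ x+y≈-[x-y] → x≉0 (two*x≈0⇒x≈0 (begin
      two * x                ≈⟨ solve 2 (λ x y → 𝟚 :* x := (x :+ y) :+ (x :- y)) refl x y ⟩
      (x + y) + (x - y)      ≈⟨ +-congʳ x+y≈-[x-y] ⟩
      - (x - y) + (x - y)    ≈⟨ -‿inverseˡ _ ⟩
      0#                     ∎)))

  parent-edge : ∀ {a b t} → InV a b → InV (a + t) (a - t) → (a + t) * (a - t) ≈ b * b →
                Edge (a + t) (a - t) a b
  parent-edge {a} {b} {t} vab v prod≈b² = v , vab , (b , sym prod≈b²) , sym mean≈a , sym prod≈b²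
    where
    mean≈a : ((a + t) + (a - t)) * half ≈ a
    mean≈a = trans (*-congʳ (solve 2 (λ a t → (a :+ t) :+ (a :- t) := 𝟚 :* a) refl a t)) ([two*x]*half≈x a)

  mean²≉product : ∀ {c d} → ¬ c ≈ d → ¬ (c + d) * half * ((c + d) * half) ≈ c * d
  mean²≉product {c} {d} c≉d m²≈cd =
    x≉0∧y≉0⇒x*y≉0 gap≉0 gap≉0 (trans (sym (agm-gap refl m²≈cd)) (-‿inverseʳ _))
    where
    gap≉0 : ¬ (c - d) * half ≈ 0#
    gap≉0 = x≉0∧y≉0⇒x*y≉0 (x≉y⇒x-y≉0 c≉d) half≉0

  hasChild⇔IsSquare : ∀ {c d} → InV c d → HasChild c d ⇔ IsSquare (c * d)
  hasChild⇔IsSquare {c} {d} vcd@(c≉0 , d≉0 , c≉d , c≉-d) = mk⇔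
    (λ (_ , _ , _ , _ , square , _) → square)
    (λ (s , s²≈cd) → m , s , vcd , child s²≈cd , (s , s²≈cd) , refl , s²≈cd)
    where
    m : Carrier
    m = (c + d) * half
    child : ∀ {s} → s * s ≈ c * d → InV m s
    child {s} s²≈cd =
      x≉0∧y≉0⇒x*y≉0 (x≉-y⇒x+y≉0 c≉-d) half≉0 ,
      x*x≈y∧y≉0⇒x≉0 s²≈cd (x≉0∧y≉0⇒x*y≉0 c≉0 d≉0) ,
      (λ m≈s → mean²≉product c≉d (trans (*-cong m≈s m≈s) s²≈cd)) ,
      (λ m≈-s → mean²≉product c≉d (trans (*-cong m≈-s m≈-s) (trans (solve 1 (λ s → :- s :* :- s := s :* s) refl s) s²≈cd)))

  hasGrandparent⇔ : ∀ {a b} → InV a b →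
                    HasGrandparent a b ⇔ (∃ λ t → t * t ≈ a * a - b * b × IsSquare (a * t))
  hasGrandparent⇔ {a} {b} vab@(a≉0 , b≉0 , _) = mk⇔ offset grandparent
    where
    offset : HasGrandparent a b → ∃ λ t → t * t ≈ a * a - b * b × IsSquare (a * t)
    offset (a₁ , b₁ , a₂ , b₂ , (_ , _ , _ , a₁≈mean , b₁²≈a₂b₂) , (_ , _ , _ , a≈mean , b²≈a₁b₁)) =
      a₁ - a , t²≈a²-b² , v * half , sym (two*two*x≈v²⇒x≈[v*half]² 4at≈v²)
      where
      v : Carrier
      v = (a₂ - b₂) * half
      b₁≈2a-a₁ : b₁ ≈ two * a - a₁
      b₁≈2a-a₁ = mean⇒partner a≈mean
      t²≈a²-b² : (a₁ - a) * (a₁ - a) ≈ a * a - b * b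
      t²≈a²-b² = begin
        (a₁ - a) * (a₁ - a)            ≈⟨ solve 2 (λ a a₁ → (a₁ :- a) :* (a₁ :- a) := a :* a :- a₁ :* (𝟚 :* a :- a₁))
                                                  refl a a₁ ⟩
        a * a - a₁ * (two * a - a₁)    ≈⟨ +-congˡ (-‿cong (*-congˡ b₁≈2a-a₁)) ⟨
        a * a - a₁ * b₁                ≈⟨ +-congˡ (-‿cong b²≈a₁b₁) ⟨
        a * a - b * b                  ∎
      4at≈v² : two * two * (a * (a₁ - a)) ≈ v * v
      4at≈v² = begin
        two * two * (a * (a₁ - a))
          ≈⟨ solve 2 (λ a a₁ → 𝟚 :* 𝟚 :* (a :* (a₁ :- a)) := a₁ :* a₁ :- (𝟚 :* a :- a₁) :* (𝟚 :* a :- a₁))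
                     refl a a₁ ⟩
        a₁ * a₁ - (two * a - a₁) * (two * a - a₁)
          ≈⟨ +-congˡ (-‿cong (*-cong b₁≈2a-a₁ b₁≈2a-a₁)) ⟨
        a₁ * a₁ - b₁ * b₁
          ≈⟨ agm-gap a₁≈mean b₁²≈a₂b₂ ⟩
        v * v
          ∎

    grandparent : (∃ λ t → t * t ≈ a * a - b * b × IsSquare (a * t)) → HasGrandparent a b
    grandparent (t , t²≈a²-b² , s , s²≈at) =
      a + t , a - t , (a + t) + w , (a + t) - w , parent-edge v₁ v₂ prod₂ , parent-edge vab v₁ prod₁
      where
      w : Carrier
      w = two * s
      t≉0 : ¬ t ≈ 0#
      t≉0 = x*x≈y∧y≉0⇒x≉0 t²≈a²-b² (InV⇒a²-b²≉0 vab)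
      w≉0 : ¬ w ≈ 0#
      w≉0 = x≉0∧y≉0⇒x*y≉0 two≉0 (x*x≈y∧y≉0⇒x≉0 s²≈at (x≉0∧y≉0⇒x*y≉0 a≉0 t≉0))
      prod₁ : (a + t) * (a - t) ≈ b * b
      prod₁ = begin
        (a + t) * (a - t)          ≈⟨ solve 2 (λ a t → (a :+ t) :* (a :- t) := a :* a :- t :* t) refl a t ⟩
        a * a - t * t              ≈⟨ +-congˡ (-‿cong t²≈a²-b²) ⟩
        a * a - (a * a - b * b)    ≈⟨ solve 2 (λ a b → a :* a :- (a :* a :- b :* b) := b :* b) refl a b ⟩
        b * b                      ∎
      v₁ : InV (a + t) (a - t)
      v₁ = InV-± a≉0 t≉0 (λ p≈0 → x≉0∧y≉0⇒x*y≉0 b≉0 b≉0 (trans (sym prod₁) p≈0))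
      a+t≉0 : ¬ a + t ≈ 0#
      a+t≉0 = proj₁ v₁
      a-t≉0 : ¬ a - t ≈ 0#
      a-t≉0 = proj₁ (proj₂ v₁)
      prod₂ : ((a + t) + w) * ((a + t) - w) ≈ (a - t) * (a - t)
      prod₂ = begin
        ((a + t) + w) * ((a + t) - w)
          ≈⟨ solve 3 (λ a t s → (a :+ t :+ 𝟚 :* s) :* (a :+ t :- 𝟚 :* s) := (a :+ t) :* (a :+ t) :- 𝟚 :* 𝟚 :* (s :* s))
                     refl a t s ⟩
        (a + t) * (a + t) - two * two * (s * s)
          ≈⟨ +-congˡ (-‿cong (*-congˡ s²≈at)) ⟩
        (a + t) * (a + t) - two * two * (a * t)
          ≈⟨ solve 2 (λ a t → (a :+ t) :* (a :+ t) :- 𝟚 :* 𝟚 :* (a :* t) := (a :- t) :* (a :- t)) refl a t ⟩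
        (a - t) * (a - t)
          ∎
      v₂ : InV ((a + t) + w) ((a + t) - w)
      v₂ = InV-± a+t≉0 w≉0 (λ p≈0 → x≉0∧y≉0⇒x*y≉0 a-t≉0 a-t≉0 (trans (sym prod₂) p≈0))

module FiniteFieldProperties {q} (F : Field) (card : HasCard F q) where
  open Field F
  open Aquarium F using (two; IsSquare)
  open HasCard card
  open FieldProperties F
  open IntegerCoefficientSolver commRing
  open import Algebra.Properties.Ring ring using (-0#≈0#; -‿involutive; -‿injective; -‿distribʳ-*)
  open import Relation.Binary.Reasoning.Setoid setoid

  _≟_ : Decidable _≈_
  x ≟ y with enum-surj x | enum-surj y
  ... | i , i↦x | j , j↦y = map′ (λ i≡j → trans (sym i↦x) (trans (reflexive (≡.cong enum i≡j)) j↦y))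
                                 (λ x≈y → enum-inj i j (trans i↦x (trans x≈y (sym j↦y))))
                                 (i Fin.≟ j)

  decSetoid : DecSetoid 0ℓ 0ℓ
  decSetoid = record { isDecEquivalence = record { isEquivalence = isEquivalence ; _≟_ = _≟_ } }

  open OrbitCounting decSetoid
  open DecidableFieldProperties F _≟_
  open import Data.List.Membership.Setoid setoid using (_∈_)
  open import Data.List.Membership.Setoid.Properties using (∈-resp-≈; ∈-tabulate⁺; ∉⇒All[≉]; All[≉]⇒∉)
  open import Data.List.Relation.Unary.Unique.Setoid setoid using (Unique)
  open import Data.List.Relation.Unary.Unique.Setoid.Properties using (tabulate⁺)

  elements : List Carrier
  elements = tabulate enum

  elements-unique : Unique elements
  elements-unique = tabulate⁺ setoid (enum-inj _ _)

  ∈-elements : ∀ x → x ∈ elements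
  ∈-elements x with enum-surj x
  ... | i , i↦x = ∈-resp-≈ setoid i↦x (∈-tabulate⁺ setoid i)

  2∤q⇒two≉0 : ¬ 2 ∣ q → ¬ two ≈ 0#
  2∤q⇒two≉0 2∤q two≈0 = 2∤q (≡.subst (2 ∣_) (length-tabulate enum)
    (FreeInvolution.2∣length {σ = _+ 1#} +-congʳ involutive elements-unique ((λ _ → ∈-elements _) , λ _ → free _)))
    where
    involutive : ∀ x → x + 1# + 1# ≈ x
    involutive x = trans (+-assoc x 1# 1#) (trans (+-congˡ two≈0) (+-identityʳ x))
    free : ∀ x → ¬ x ≈ x + 1#
    free x x≈x+1 = 1≉0 (begin
      1#              ≈⟨ solve 2 (λ x o → o := (x :+ o) :- x) refl x 1# ⟩
      (x + 1#) - x    ≈⟨ +-congʳ x≈x+1 ⟨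
      x - x           ≈⟨ -‿inverseʳ x ⟩
      0#              ∎)

  module _ (two≉0 : ¬ two ≈ 0#) where
    open OddCharacteristic F two≉0 using (x≈-x⇒x≈0)

    exceptional : List Carrier
    exceptional = 0# ∷ 1# ∷ - 1# ∷ []

    generic : List Carrier
    generic = elements ∖ exceptional

    Generic : Carrier → Set
    Generic y = All (λ z → ¬ y ≈ z) exceptional

    ∈-generic⁺ : ∀ {y} → Generic y → y ∈ generic
    ∈-generic⁺ {y} y≉ = ∈-∖⁺ (∈-elements y) (All[≉]⇒∉ setoid y≉)

    ∈-generic⁻ : ∀ {y} → y ∈ generic → Generic y
    ∈-generic⁻ y∈ = ∉⇒All[≉] setoid (proj₂ (∈-∖⁻ {L = elements} {B = exceptional} y∈))

    length-elements : length elements ≡ 3 ℕ.+ length generic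
    length-elements = length-∖ elements-unique exceptional-unique (∈-elements 0# ∷ ∈-elements 1# ∷ ∈-elements (- 1#) ∷ [])
      where
      exceptional-unique : Unique exceptional
      exceptional-unique =
        ((λ 0≈1 → 1≉0 (sym 0≈1)) ∷ (λ 0≈-1 → 1≉0 (-‿injective (trans (sym 0≈-1) (sym -0#≈0#)))) ∷ []) ∷
        ((λ 1≈-1 → two≉0 (trans (+-congʳ 1≈-1) (-‿inverseˡ 1#))) ∷ []) ∷ [] ∷ []

    module _ (-1-nonsquare : ¬ IsSquare (- 1#)) where
      open KleinFour {σ = -_} {τ = recip} -‿cong recip-cong -‿involutive recip-involutive -‿recip

      recip-swap : ∀ {y z w} → recip y ≈ z → recip z ≈ w → y ≈ w
      recip-swap {y} ry≈z rz≈w = trans (sym (recip-involutive y)) (trans (recip-cong ry≈z) rz≈w)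

      neg-generic : ∀ {y} → Generic y → Generic (- y)
      neg-generic {y} (y≉0 ∷ y≉1 ∷ y≉-1 ∷ []) =
        (λ -y≈0 → y≉0 (-‿injective (trans -y≈0 (sym -0#≈0#)))) ∷
        (λ -y≈1 → y≉-1 (trans (sym (-‿involutive y)) (-‿cong -y≈1))) ∷
        (λ -y≈-1 → y≉1 (-‿injective -y≈-1)) ∷ []

      recip-generic : ∀ {y} → Generic y → Generic (recip y)
      recip-generic {y} (y≉0 ∷ y≉1 ∷ y≉-1 ∷ []) =
        (λ ry≈0 → 1≉0 (trans (sym (recip-inverseʳ y≉0)) (trans (*-congˡ ry≈0) (zeroʳ y)))) ∷
        (λ ry≈1 → y≉1 (recip-swap ry≈1 (recip-unique (*-identityˡ 1#)))) ∷
        (λ ry≈-1 → y≉-1 (recip-swap ry≈-1 (recip-unique (solve 0 (:- con (+ 1) :* :- con (+ 1) := con (+ 1)) refl)))) ∷ []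

      orbit-unique : ∀ {y} → Generic y → Unique (orbit y)
      orbit-unique {y} y≉@(y≉0 ∷ y≉1 ∷ y≉-1 ∷ []) =
        (y≉-y ∷ y≉r ∷ y≉-r ∷ []) ∷
        ((λ -y≈r → y≉-r (trans (sym (-‿involutive y)) (-‿cong -y≈r))) ∷ (y≉r ∘ -‿injective) ∷ []) ∷
        ((r≉0 ∘ x≈-x⇒x≈0) ∷ []) ∷ [] ∷ []
        where
        r = recip y
        r≉0 : ¬ r ≈ 0#
        r≉0 with recip-generic y≉
        ... | r≉0 ∷ _ = r≉0
        y≉-y : ¬ y ≈ - y
        y≉-y = y≉0 ∘ x≈-x⇒x≈0
        y≉r : ¬ y ≈ r
        y≉r y≈r with x²≈y²⇒x≈±y (trans (*-congˡ y≈r) (trans (recip-inverseʳ y≉0) (sym (*-identityˡ 1#))))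
        ... | inj₁ y≈1  = y≉1 y≈1
        ... | inj₂ y≈-1 = y≉-1 y≈-1
        y≉-r : ¬ y ≈ - r
        y≉-r y≈-r = -1-nonsquare (y , (begin
          y * y        ≈⟨ *-congˡ y≈-r ⟩
          y * - r      ≈⟨ -‿distribʳ-* y r ⟨
          - (y * r)    ≈⟨ -‿cong (recip-inverseʳ y≉0) ⟩
          - 1#         ∎))

      4∣length-generic : 4 ∣ length generic
      4∣length-generic = 4∣length (∖-unique exceptional elements-unique)
        ( (λ y∈ → ∈-generic⁺ (neg-generic (∈-generic⁻ y∈)))
        , (λ y∈ → ∈-generic⁺ (recip-generic (∈-generic⁻ y∈)))
        , orbit-unique ∘ ∈-generic⁻ )

  q%4≡1⇒-1-IsSquare : q % 4 ≡ 1 → IsSquare (- 1#)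
  q%4≡1⇒-1-IsSquare q%4≡1 with any? (λ s → (s * s) ≟ (- 1#)) elements
  ... | yes found = Any.satisfied found
  ... | no  none  = contradiction (≡.trans (≡.sym (length-tabulate enum)) (length-elements two≉0))
                                  (q%4≡1⇒q≢3+4k q%4≡1 (4∣length-generic two≉0 -1-nonsquare))
    where
    two≉0 : ¬ two ≈ 0#
    two≉0 = 2∤q⇒two≉0 (q%4≡1⇒2∤q q%4≡1)
    -1-nonsquare : ¬ IsSquare (- 1#)
    -1-nonsquare (s , s²≈-1) = none (Any.map (λ s≈e → trans (*-cong (sym s≈e) (sym s≈e)) s²≈-1) (∈-elements s))

lemma3p6 : (q : ℕ) → IsPrimePower q → q % 4 ≡ 1 → (F : Field) → HasCard F q →
    let open Field F
        open Aquarium F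
    in ∀ a b c d → InV a b → InV c d → lam c d ≈ 1# - lam a b →
       (HasGrandparent a b ⇔ HasChild c d)
lemma3p6 q _ q%4≡1 F card a b c d vab@(a≉0 , _) vcd@(c≉0 , _) λcd≈1-λab = begin
  HasGrandparent a b                                    ∼⟨ hasGrandparent⇔ vab ⟩
  (∃ λ t → t * t ≈ a * a - b * b × IsSquare (a * t))    ∼⟨ IsSquare-at-root⇔ -1-square r²≈a²-b² ⟩
  IsSquare (a * r)                                      ∼⟨ IsSquare-cong (a*[a*d*c⁻¹]≈[a*c⁻¹]²*[c*d] d c≉0) ⟩
  IsSquare (u * u * (c * d))                            ∼⟨ IsSquare-*-square⇔ u≉0 ⟩
  IsSquare (c * d)                                      ∼⟨ ⇔-sym (hasChild⇔IsSquare vcd) ⟩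
  HasChild c d                                          ∎
  where
  open Field F
  open Aquarium F
  open FieldProperties F
  open FiniteFieldProperties F card
  open DecidableFieldProperties F _≟_
  open AquariumProperties F (2∤q⇒two≉0 (q%4≡1⇒2∤q q%4≡1))
  open EquationalReasoning {k = equivalence}
  -1-square : IsSquare (- 1#)
  -1-square = q%4≡1⇒-1-IsSquare q%4≡1
  r u : Carrier
  r = a * d * c ⁻¹
  u = a * c ⁻¹
  r²≈a²-b² : r * r ≈ a * a - b * b
  r²≈a²-b² = lam-complement⇒root a≉0 c≉0 λcd≈1-λab
  u≉0 : ¬ u ≈ 0#
  u≉0 = x≉0∧y≉0⇒x*y≉0 a≉0 (⁻¹-≉0 c≉0)
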